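{- Let $n \geq 3$ and let $C_n$ be the cycle on $n$ vertices. If $n \not\equiv 1 \pmod 3$ and $n \neq 5$, then $\chi_s(S(C_n)) = 4$; otherwise (i.e. if $n \equiv 1 \pmod 3$ or $n = 5$), $\chi_s(S(C_n)) \leq 5$.
   Context: All graphs are finite, simple and undirected. A star coloring of a graph $G$ is a proper vertex coloring of $G$ in which every path on four vertices uses at least three distinct colors. The star chromatic number $\chi_s(G)$ is the least number of colors in a star coloring of $G$. The splitting graph $S(G)$ of a graph $G$ is obtained from $G$ by adding, for each vertex $v$ of $G$, a new vertex $v'$ whose neighborhood is $N(v')=N(v)$, the neighborhood of $v$ in $G$ (the new vertices are pairwise nonadjacent). -}

module Defs where

open import Data.Nat using (ℕ; suc; _<_; _%_)
open import Data.Fin using (Fin; toℕ)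
open import Data.Sum using (_⊎_; inj₁; inj₂)
open import Data.Product using (_×_; ∃-syntax)
open import Data.Empty using (⊥)
open import Relation.Nullary using (¬_)
open import Relation.Binary.PropositionalEquality using (_≡_; _≢_)

-- A graph is given by a vertex type V and an adjacency relation on V
-- (for the graphs used here it is symmetric and irreflexive, i.e. simple).

Proper : {V : Set} (Adj : V → V → Set) {k : ℕ} → (V → Fin k) → Set
Proper {V} Adj c = ∀ (u v : V) → Adj u v → c u ≢ c v

IsP4 : {V : Set} (Adj : V → V → Set) → V → V → V → V → Set
IsP4 Adj a b c d =
  (a ≢ b) × (a ≢ c) × (a ≢ d) × (b ≢ c) × (b ≢ d) × (c ≢ d) ×
  Adj a b × Adj b c × Adj c d

AtLeast3Colours : {k : ℕ} {V : Set} → (V → Fin k) → V → V → V → V → Set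
AtLeast3Colours col a b c d =
  Distinct3 (col a) (col b) (col c) ⊎ Distinct3 (col a) (col b) (col d) ⊎
  Distinct3 (col a) (col c) (col d) ⊎ Distinct3 (col b) (col c) (col d)
  where
  Distinct3 : {k : ℕ} → Fin k → Fin k → Fin k → Set
  Distinct3 x y z = (x ≢ y) × (x ≢ z) × (y ≢ z)

StarColouring : {V : Set} (Adj : V → V → Set) {k : ℕ} → (V → Fin k) → Set
StarColouring {V} Adj col =
  Proper Adj col ×
  (∀ (a b c d : V) → IsP4 Adj a b c d → AtLeast3Colours col a b c d)

StarColourable : {V : Set} (Adj : V → V → Set) → ℕ → Set
StarColourable {V} Adj k = ∃[ col ] StarColouring {V} Adj {k} col

StarChromaticNumberIs : {V : Set} (Adj : V → V → Set) → ℕ → Set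
StarChromaticNumberIs Adj k =
  StarColourable Adj k × (∀ j → j < k → ¬ StarColourable Adj j)

StarChromaticAtMost : {V : Set} (Adj : V → V → Set) → ℕ → Set
StarChromaticAtMost Adj k = StarColourable Adj k

CycleAdj : (n : ℕ) → Fin n → Fin n → Set
CycleAdj (suc m) i j =
  (suc (toℕ i) % suc m ≡ toℕ j) ⊎ (suc (toℕ j) % suc m ≡ toℕ i)

-- Splitting graph S(G): vertices inj₁ v (original) and inj₂ v (the copy v'),
-- with N(v') = N(v) and the copies pairwise nonadjacent.
SplitAdj : {V : Set} → (V → V → Set) → V ⊎ V → V ⊎ V → Set
SplitAdj Adj (inj₁ u) (inj₁ v) = Adj u v
SplitAdj Adj (inj₁ u) (inj₂ v) = Adj u v
SplitAdj Adj (inj₂ u) (inj₁ v) = Adj u v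
SplitAdj Adj (inj₂ u) (inj₂ v) = ⊥

module Submission where

-- Neither S(P₄) nor S(C₃) has a star 3-colouring; both facts are decided by
-- exhaustive search, using a decision procedure for star colourings of finite graphs.  For
-- n ≥ 4, S(P₄) is a subgraph of S(C_n), and star colourings restrict to subgraphs.
--
-- A colouring of S(C_n) is a cyclic word of n columns (the colours of vᵢ and
-- vᵢ′).  Being a star colouring is local: every walk with three edges of S(C_n), in particular
-- every edge and every P4, lies in the image of a window S(P₄) → S(C_n) on four consecutive
-- positions (walks of C_n lift to the line ℕ, and the lifting passes to splitting graphs).  So a
-- word star colours S(C_n) once each cyclic window of four consecutive columns star colours
-- S(P₄).  A word (a₁a₂a₃)^(j+1) T inherits this from a₁a₂a₃T and the three periodic windows;
-- finitely many checked words then give 4 colours when n ≢ 1 (mod 3) and n ≠ 5, and 5 colours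
-- otherwise.

open import Defs
open import Data.Nat using (ℕ; zero; suc; _+_; _*_; _∸_; _≤_; _<_; z≤n; s≤s; _%_; NonZero)
import Data.Nat as ℕ
open import Data.Nat.Properties using (≤-trans; +-suc; +-comm; m≤n+m; n≤1+n; *-monoʳ-≤; _<?_; ≮⇒≥; m+n∸m≡n; ∸-monoˡ-<; +-mono-≤-<)
open import Data.Nat.DivMod using (_mod_; %-distribˡ-+; m%n%n≡m%n; [m+n]%n≡m%n; [m+kn]%n≡m%n; m<n⇒m%n≡m; m%n<n; m≤n⇒[n∸m]%m≡n%m)
open import Data.Fin using (Fin; toℕ; inject≤; #_)
import Data.Fin as Fin
open import Data.Fin.Properties using (all?; toℕ-injective; toℕ<n; toℕ-fromℕ<; toℕ-inject≤; inject≤-injective)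
open import Data.Vec using (Vec; []; _∷_; lookup; tabulate)
open import Data.Vec.Properties using (lookup∘tabulate)
open import Data.Sum using (_⊎_; inj₁; inj₂)
import Data.Sum as Sum
open import Data.Sum.Properties using (inj₁-injective; inj₂-injective)
import Data.Sum.Properties as SumP
open import Data.Product using (_×_; _,_; proj₁; proj₂; ∃-syntax)
open import Data.List using (List; []; _∷_; _++_; take; length; concat; replicate)
open import Data.List.Properties using (length-++)
open import Data.Unit using (⊤; tt)
open import Data.Empty using (⊥-elim)
open import Function using (_∘_)
open import Relation.Nullary using (¬_; Dec; yes; no)
open import Relation.Nullary.Decidable using (_×-dec_; _⊎-dec_; _→-dec_; ¬?; map′; from-yes; True; toWitness)
open import Relation.Binary.Definitions using (DecidableEquality)
open import Relation.Binary.PropositionalEquality using (_≡_; _≢_; refl; sym; trans; cong; subst; _≗_; module ≡-Reasoning)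

-- A colouring that separates every pair of vertices separated by a star colouring
-- is itself a star colouring: both defining conditions only ask for distinct colours.
star-finer : ∀ {V : Set} {Adj : V → V → Set} {j k} {f : V → Fin j} {g : V → Fin k} →
  (∀ {x y} → f x ≢ f y → g x ≢ g y) → StarColouring Adj f → StarColouring Adj g
star-finer {f = f} {g} sep (proper , p4) =
  (λ u v uv → sep (proper u v uv)) , (λ a b c d abcd → transport (p4 a b c d abcd))
  where
  triple : ∀ {x y z} → (f x ≢ f y) × (f x ≢ f z) × (f y ≢ f z) → (g x ≢ g y) × (g x ≢ g z) × (g y ≢ g z)
  triple (xy , xz , yz) = sep xy , sep xz , sep yz
  transport : ∀ {a b c d} → AtLeast3Colours f a b c d → AtLeast3Colours g a b c d
  transport (inj₁ t) = inj₁ (triple t)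
  transport (inj₂ (inj₁ t)) = inj₂ (inj₁ (triple t))
  transport (inj₂ (inj₂ (inj₁ t))) = inj₂ (inj₂ (inj₁ (triple t)))
  transport (inj₂ (inj₂ (inj₂ t))) = inj₂ (inj₂ (inj₂ (triple t)))

star-cong : ∀ {V : Set} {Adj : V → V → Set} {k} {f g : V → Fin k} → f ≗ g →
  StarColouring Adj f → StarColouring Adj g
star-cong {f = f} {g} f≗g = star-finer λ {x} {y} fx≢fy gx≡gy → fx≢fy (trans (f≗g x) (trans gx≡gy (sym (f≗g y))))

star-colourable-mono : ∀ {V : Set} {Adj : V → V → Set} {j k} → j ≤ k → StarColourable Adj j → StarColourable Adj k
star-colourable-mono j≤k (col , star) =
  _ , star-finer (λ fx≢fy → fx≢fy ∘ inject≤-injective j≤k j≤k _ _) star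

star-restrict : ∀ {V W : Set} {A : V → V → Set} {B : W → W → Set} {k} {col : V → Fin k} (e : W → V) →
  (∀ {x y} → B x y → A (e x) (e y)) → (∀ {x y} → e x ≡ e y → x ≡ y) →
  StarColouring A col → StarColouring B (col ∘ e)
star-restrict e hom inj (proper , p4) =
  (λ u v uv → proper (e u) (e v) (hom uv)) ,
  (λ { a b c d (ab , ac , ad , bc , bd , cd , a~b , b~c , c~d) →
       p4 (e a) (e b) (e c) (e d) (ab ∘ inj , ac ∘ inj , ad ∘ inj , bc ∘ inj , bd ∘ inj , cd ∘ inj ,
                                   hom a~b , hom b~c , hom c~d) })

-- Walks with three edges; every edge a~b gives the walk a~b~a~b in a symmetric graph.
Walk3 : {V : Set} → (V → V → Set) → V → V → V → V → Set
Walk3 Adj a b c d = Adj a b × Adj b c × Adj c d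

record Covered {S U V : Set} (φ : S → U → V) (A : U → U → Set) (a b c d : V) : Set where
  constructor covered
  field
    index : S
    {a′ b′ c′ d′} : U
    walk : Walk3 A a′ b′ c′ d′
    images : (φ index a′ ≡ a) × (φ index b′ ≡ b) × (φ index c′ ≡ c) × (φ index d′ ≡ d)

WalksCovered : {S U V : Set} → (S → U → V) → (U → U → Set) → (V → V → Set) → Set
WalksCovered φ A B = ∀ {a b c d} → Walk3 B a b c d → Covered φ A a b c d

-- Local-to-global principle: if every walk with three edges of a symmetric graph B lies in
-- the image of some φ s, and every pulled-back colouring col ∘ φ s star colours A, then col
-- star colours B.  (Edges and P4s are walks; distinct vertices have distinct preimages.)
star-local : ∀ {S U V : Set} {A : U → U → Set} {B : V → V → Set} {k} {φ : S → U → V} {col : V → Fin k} →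
  (∀ {x y} → B x y → B y x) → WalksCovered φ A B → (∀ s → StarColouring A (col ∘ φ s)) →
  StarColouring B col
star-local {A = A} {B} {φ = φ} {col} sym-B cover local = proper , p4
  where
  proper : Proper B col
  proper u v u~v with cover (u~v , sym-B u~v , u~v)
  ... | covered s (a~b , _) (refl , refl , _) = proj₁ (local s) _ _ a~b
  p4 : ∀ a b c d → IsP4 B a b c d → AtLeast3Colours col a b c d
  p4 a b c d (ab , ac , ad , bc , bd , cd , a~b , b~c , c~d) with cover (a~b , b~c , c~d)
  ... | covered s walk (refl , refl , refl , refl) =
    proj₂ (local s) _ _ _ _ (ab ∘ cong (φ s) , ac ∘ cong (φ s) , ad ∘ cong (φ s) ,
                             bc ∘ cong (φ s) , bd ∘ cong (φ s) , cd ∘ cong (φ s) , walk)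

splitMap : {U V : Set} → (U → V) → U ⊎ U → V ⊎ V
splitMap f = Sum.map f f

base : {V : Set} → V ⊎ V → V
base = Sum.reduce

module _ {U V : Set} {A : U → U → Set} {B : V → V → Set} where

  split-base : ∀ {x y} → SplitAdj B x y → B (base x) (base y)
  split-base {inj₁ _} {inj₁ _} x~y = x~y
  split-base {inj₁ _} {inj₂ _} x~y = x~y
  split-base {inj₂ _} {inj₁ _} x~y = x~y

  split-hom : ∀ {f : U → V} → (∀ {x y} → A x y → B (f x) (f y)) →
    ∀ {x y} → SplitAdj A x y → SplitAdj B (splitMap f x) (splitMap f y)
  split-hom hom {inj₁ _} {inj₁ _} x~y = hom x~y
  split-hom hom {inj₁ _} {inj₂ _} x~y = hom x~y
  split-hom hom {inj₂ _} {inj₁ _} x~y = hom x~y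

  -- Walks in S(G) are walks in G decorated with "original or copy" tags (never two copies
  -- in a row), so covering the walks of G by A covers the walks of S(G) by S(A).
  split-cover : ∀ {S : Set} {φ : S → U → V} → WalksCovered φ A B →
    WalksCovered (splitMap ∘ φ) (SplitAdj A) (SplitAdj B)
  split-cover {φ = φ} cover {a} {b} {c} {d} (a~b , b~c , c~d)
    with cover (split-base {a} {b} a~b , split-base {b} {c} b~c , split-base {c} {d} c~d)
  ... | covered s {a′} {b′} {c′} {d′} (a′~b′ , b′~c′ , c′~d′) (ea , eb , ec , ed) =
    covered s {retag a a′} {retag b b′} {retag c c′} {retag d d′}
      (retag-adj {a} {b} a~b a′~b′ , retag-adj {b} {c} b~c b′~c′ , retag-adj {c} {d} c~d c′~d′)
      (retag-image a ea , retag-image b eb , retag-image c ec , retag-image d ed)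
    where
    retag : V ⊎ V → U → U ⊎ U
    retag x o = Sum.map (λ _ → o) (λ _ → o) x
    retag-adj : ∀ {x y o o′} → SplitAdj B x y → A o o′ → SplitAdj A (retag x o) (retag y o′)
    retag-adj {inj₁ _} {inj₁ _} _ o~o′ = o~o′
    retag-adj {inj₁ _} {inj₂ _} _ o~o′ = o~o′
    retag-adj {inj₂ _} {inj₁ _} _ o~o′ = o~o′
    retag-image : ∀ x {o} → φ s o ≡ base x → splitMap (φ s) (retag x o) ≡ x
    retag-image (inj₁ _) refl = refl
    retag-image (inj₂ _) refl = refl

split-sym : ∀ {V : Set} {A : V → V → Set} → (∀ {x y} → A x y → A y x) →
  ∀ {x y} → SplitAdj A x y → SplitAdj A y x
split-sym sym-A {inj₁ _} {inj₁ _} x~y = sym-A x~y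
split-sym sym-A {inj₁ _} {inj₂ _} x~y = sym-A x~y
split-sym sym-A {inj₂ _} {inj₁ _} x~y = sym-A x~y

splitMap-injective : ∀ {U V : Set} {f : U → V} → (∀ {x y} → f x ≡ f y → x ≡ y) →
  ∀ {x y} → splitMap f x ≡ splitMap f y → x ≡ y
splitMap-injective inj {inj₁ _} {inj₁ _} e = cong inj₁ (inj (inj₁-injective e))
splitMap-injective inj {inj₂ _} {inj₂ _} e = cong inj₂ (inj (inj₂-injective e))
splitMap-injective inj {inj₁ _} {inj₂ _} ()
splitMap-injective inj {inj₂ _} {inj₁ _} ()

%-absorbʳ : ∀ a b n .{{_ : NonZero n}} → (a + b % n) % n ≡ (a + b) % n
%-absorbʳ a b n = begin
  (a + b % n) % n           ≡⟨ %-distribˡ-+ a (b % n) n ⟩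
  (a % n + b % n % n) % n   ≡⟨ cong (λ r → (a % n + r) % n) (m%n%n≡m%n b n) ⟩
  (a % n + b % n) % n       ≡⟨ %-distribˡ-+ a b n ⟨
  (a + b) % n               ∎
  where open ≡-Reasoning

suc-%-cancel : ∀ a b m → suc a % suc m ≡ suc b % suc m → a % suc m ≡ b % suc m
suc-%-cancel a b m e = begin
  a % n                  ≡⟨ [m+n]%n≡m%n a n ⟨
  (a + n) % n            ≡⟨ cong (_% n) (shift a) ⟩
  (m + suc a) % n        ≡⟨ %-absorbʳ m (suc a) n ⟨
  (m + suc a % n) % n    ≡⟨ cong (λ r → (m + r) % n) e ⟩
  (m + suc b % n) % n    ≡⟨ %-absorbʳ m (suc b) n ⟩
  (m + suc b) % n        ≡⟨ cong (_% n) (shift b) ⟨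
  (b + n) % n            ≡⟨ [m+n]%n≡m%n b n ⟩
  b % n                  ∎
  where
  open ≡-Reasoning
  n = suc m
  shift : ∀ x → x + n ≡ m + suc x
  shift x = trans (+-comm x n) (sym (+-suc m x))

LineAdj : ℕ → ℕ → Set
LineAdj p q = suc p ≡ q ⊎ suc q ≡ p

PathAdj : (m : ℕ) → Fin m → Fin m → Set
PathAdj m i j = LineAdj (toℕ i) (toℕ j)

line-cover : WalksCovered (λ s o → toℕ o + s) (PathAdj 4) LineAdj
line-cover {a} (inj₁ refl , inj₁ refl , inj₁ refl) =
  covered a {# 0} {# 1} {# 2} {# 3} (inj₁ refl , inj₁ refl , inj₁ refl) (refl , refl , refl , refl)
line-cover {a} (inj₁ refl , inj₁ refl , inj₂ refl) =
  covered a {# 0} {# 1} {# 2} {# 1} (inj₁ refl , inj₁ refl , inj₂ refl) (refl , refl , refl , refl)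
line-cover {a} (inj₁ refl , inj₂ refl , inj₁ refl) =
  covered a {# 0} {# 1} {# 0} {# 1} (inj₁ refl , inj₂ refl , inj₁ refl) (refl , refl , refl , refl)
line-cover {d = d} (inj₁ refl , inj₂ refl , inj₂ refl) =
  covered d {# 1} {# 2} {# 1} {# 0} (inj₁ refl , inj₂ refl , inj₂ refl) (refl , refl , refl , refl)
line-cover {b = b} (inj₂ refl , inj₁ refl , inj₁ refl) =
  covered b {# 1} {# 0} {# 1} {# 2} (inj₂ refl , inj₁ refl , inj₁ refl) (refl , refl , refl , refl)
line-cover {b = b} (inj₂ refl , inj₁ refl , inj₂ refl) =
  covered b {# 1} {# 0} {# 1} {# 0} (inj₂ refl , inj₁ refl , inj₂ refl) (refl , refl , refl , refl)
line-cover {c = c} (inj₂ refl , inj₂ refl , inj₁ refl) =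
  covered c {# 2} {# 1} {# 0} {# 1} (inj₂ refl , inj₂ refl , inj₁ refl) (refl , refl , refl , refl)
line-cover {d = d} (inj₂ refl , inj₂ refl , inj₂ refl) =
  covered d {# 3} {# 2} {# 1} {# 0} (inj₂ refl , inj₂ refl , inj₂ refl) (refl , refl , refl , refl)

window : ∀ n .{{_ : NonZero n}} → ℕ → Fin 4 → Fin n
window n s o = (toℕ o + s) mod n

-- An edge i ~ j of C_n lifts along the projection ℕ → C_n, q ↦ q mod n, from any
-- lift q of i that is not 0; the bound on q records how far one can still step down.
cycle-step : ∀ {m k q} {i j : Fin (suc m)} → CycleAdj (suc m) i j → q % suc m ≡ toℕ i → suc k ≤ q →
  ∃[ q′ ] LineAdj q q′ × q′ % suc m ≡ toℕ j × k ≤ q′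
cycle-step {m} {k} {q} {i} {j} (inj₁ i+1≡j) q≡i k<q = suc q , inj₁ refl , forward , ≤-trans (n≤1+n k) (≤-trans k<q (n≤1+n q))
  where
  open ≡-Reasoning
  forward : suc q % suc m ≡ toℕ j
  forward = begin
    suc q % suc m              ≡⟨ %-absorbʳ 1 q (suc m) ⟨
    suc (q % suc m) % suc m    ≡⟨ cong (λ r → suc r % suc m) q≡i ⟩
    suc (toℕ i) % suc m        ≡⟨ i+1≡j ⟩
    toℕ j                      ∎
cycle-step {m} {i = i} {j} (inj₂ j+1≡i) q≡i (s≤s {n = p} k≤p) = p , inj₂ refl , backward , k≤p
  where
  open ≡-Reasoning
  backward : p % suc m ≡ toℕ j
  backward = begin
    p % suc m        ≡⟨ suc-%-cancel p (toℕ j) m (trans q≡i (sym j+1≡i)) ⟩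
    toℕ j % suc m    ≡⟨ m<n⇒m%n≡m (toℕ<n j) ⟩
    toℕ j            ∎

-- i + 3n is a lift of i ∈ C_n to the line from which one can step down three times.
high-lift : ∀ {m} (i : Fin (suc m)) → (toℕ i + 3 * suc m) % suc m ≡ toℕ i × 3 ≤ toℕ i + 3 * suc m
high-lift {m} i = trans ([m+kn]%n≡m%n (toℕ i) 3 (suc m)) (m<n⇒m%n≡m (toℕ<n i)) ,
                  ≤-trans (*-monoʳ-≤ 3 (s≤s z≤n)) (m≤n+m (3 * suc m) (toℕ i))

window-image : ∀ {m q} s (o : Fin 4) {i : Fin (suc m)} → toℕ o + s ≡ q → q % suc m ≡ toℕ i → window (suc m) s o ≡ i
window-image {m} s o refl q≡i = toℕ-injective (trans (toℕ-fromℕ< (m%n<n (toℕ o + s) (suc m))) q≡i)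

-- Every walk with three edges in C_n lies in a window: lift it to the line, starting high
-- enough never to reach 0, and cover the lifted walk by a translate of P₄.
cycle-cover : ∀ m → WalksCovered (window (suc m)) (PathAdj 4) (CycleAdj (suc m))
cycle-cover m {i₀} (i₀~i₁ , i₁~i₂ , i₂~i₃)
  with high-lift i₀
... | q₀≡i₀ , 3≤q₀ with cycle-step i₀~i₁ q₀≡i₀ 3≤q₀
... | q₁ , q₀~q₁ , q₁≡i₁ , 2≤q₁ with cycle-step i₁~i₂ q₁≡i₁ 2≤q₁
... | q₂ , q₁~q₂ , q₂≡i₂ , 1≤q₂ with cycle-step i₂~i₃ q₂≡i₂ 1≤q₂
... | q₃ , q₂~q₃ , q₃≡i₃ , _ with line-cover (q₀~q₁ , q₁~q₂ , q₂~q₃)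
... | covered s {o₀} {o₁} {o₂} {o₃} walk (e₀ , e₁ , e₂ , e₃) =
  covered s walk (window-image s o₀ e₀ q₀≡i₀ , window-image s o₁ e₁ q₁≡i₁ ,
                  window-image s o₂ e₂ q₂≡i₂ , window-image s o₃ e₃ q₃≡i₃)

Searchable : Set → Set₁
Searchable V = ∀ {P : V → Set} → (∀ x → Dec (P x)) → Dec (∀ x → P x)

search-Fin : ∀ {n} → Searchable (Fin n)
search-Fin = all?

search-⊎ : ∀ {U V : Set} → Searchable U → Searchable V → Searchable (U ⊎ V)
search-⊎ search-U search-V P? =
  map′ (λ (p , q) → Sum.[ p , q ]) (λ p → p ∘ inj₁ , p ∘ inj₂) (search-U (P? ∘ inj₁) ×-dec search-V (P? ∘ inj₂))

search-× : ∀ {U V : Set} → Searchable U → Searchable V → Searchable (U × V)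
search-× search-U search-V P? =
  map′ (λ p (x , y) → p x y) (λ p x y → p (x , y)) (search-U λ x → search-V λ y → P? (x , y))

search-Vec : ∀ {A : Set} {n} → Searchable A → Searchable (Vec A n)
search-Vec {n = zero} search-A P? = map′ (λ { p [] → p }) (λ p → p []) (P? [])
search-Vec {n = suc n} search-A P? =
  map′ (λ { p (x ∷ t) → p x t }) (λ p x t → p (x ∷ t)) (search-A λ x → search-Vec search-A λ t → P? (x ∷ t))

-- On a searchable graph with decidable equality and adjacency, being a star colouring
-- is decidable.  P4s are enumerated as walks a~b~c~d, so that non-walks are discarded early.
module _ {V : Set} (search : Searchable V) (_≟_ : DecidableEquality V)
         {Adj : V → V → Set} (adj? : ∀ u v → Dec (Adj u v)) where

  star? : ∀ {k} (col : V → Fin k) → Dec (StarColouring Adj col)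
  star? col = proper? ×-dec map′ fromWalks toWalks walks?
    where
    Distinct4 : V → V → V → V → Set
    Distinct4 a b c d = (a ≢ b) × (a ≢ c) × (a ≢ d) × (b ≢ c) × (b ≢ d) × (c ≢ d)
    WalkCondition : Set
    WalkCondition = ∀ a b → Adj a b → ∀ c → Adj b c → ∀ d → Adj c d → Distinct4 a b c d → AtLeast3Colours col a b c d
    fromWalks : WalkCondition → ∀ a b c d → IsP4 Adj a b c d → AtLeast3Colours col a b c d
    fromWalks p a b c d (ab , ac , ad , bc , bd , cd , a~b , b~c , c~d) = p a b a~b c b~c d c~d (ab , ac , ad , bc , bd , cd)
    toWalks : (∀ a b c d → IsP4 Adj a b c d → AtLeast3Colours col a b c d) → WalkCondition
    toWalks p a b a~b c b~c d c~d (ab , ac , ad , bc , bd , cd) = p a b c d (ab , ac , ad , bc , bd , cd , a~b , b~c , c~d)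
    distinct? : ∀ {A : Set} → DecidableEquality A → ∀ x y → Dec (x ≢ y)
    distinct? _≟A_ x y = ¬? (x ≟A y)
    three? : ∀ x y z → Dec ((col x ≢ col y) × (col x ≢ col z) × (col y ≢ col z))
    three? x y z = distinct? Fin._≟_ (col x) (col y) ×-dec distinct? Fin._≟_ (col x) (col z) ×-dec distinct? Fin._≟_ (col y) (col z)
    atLeast3? : ∀ a b c d → Dec (AtLeast3Colours col a b c d)
    atLeast3? a b c d = three? a b c ⊎-dec three? a b d ⊎-dec three? a c d ⊎-dec three? b c d
    distinct4? : ∀ a b c d → Dec (Distinct4 a b c d)
    distinct4? a b c d = distinct? _≟_ a b ×-dec distinct? _≟_ a c ×-dec distinct? _≟_ a d ×-dec
                         distinct? _≟_ b c ×-dec distinct? _≟_ b d ×-dec distinct? _≟_ c d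
    proper? : Dec (Proper Adj col)
    proper? = search λ u → search λ v → adj? u v →-dec distinct? Fin._≟_ (col u) (col v)
    walks? : Dec WalkCondition
    walks? = search λ a → search λ b → adj? a b →-dec search λ c → adj? b c →-dec search λ d → adj? c d →-dec
             (distinct4? a b c d →-dec atLeast3? a b c d)

line? : ∀ p q → Dec (LineAdj p q)
line? p q = (suc p ℕ.≟ q) ⊎-dec (suc q ℕ.≟ p)

path? : ∀ {m} (i j : Fin m) → Dec (PathAdj m i j)
path? i j = line? (toℕ i) (toℕ j)

cycle? : ∀ {m} (i j : Fin (suc m)) → Dec (CycleAdj (suc m) i j)
cycle? {m} i j = (suc (toℕ i) % suc m ℕ.≟ toℕ j) ⊎-dec (suc (toℕ j) % suc m ℕ.≟ toℕ i)

split? : ∀ {V : Set} {A : V → V → Set} → (∀ u v → Dec (A u v)) → ∀ x y → Dec (SplitAdj A x y)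
split? A? (inj₁ u) (inj₁ v) = A? u v
split? A? (inj₁ u) (inj₂ v) = A? u v
split? A? (inj₂ u) (inj₁ v) = A? u v
split? A? (inj₂ u) (inj₂ v) = no λ ()

-- A colouring of S(G) is a word of columns: each vertex v of G carries the pair of colours
-- of v and of its copy v′.  Every colouring of S(G) arises in this way.
Column : ℕ → Set
Column k = Fin k × Fin k

columns : ∀ {V : Set} {k} → (V → Column k) → V ⊎ V → Fin k
columns w (inj₁ v) = proj₁ (w v)
columns w (inj₂ v) = proj₂ (w v)

no-star-split : ∀ {m k} {A : Fin m → Fin m → Set} →
  (∀ (t : Vec (Column k) m) → ¬ StarColouring (SplitAdj A) (columns (lookup t))) →
  ∀ col → ¬ StarColouring (SplitAdj A) col
no-star-split no-table col star = no-table (tabulate column) (star-cong as-table star)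
  where
  column = λ v → col (inj₁ v) , col (inj₂ v)
  as-table : col ≗ columns (lookup (tabulate column))
  as-table (inj₁ v) = cong proj₁ (sym (lookup∘tabulate column v))
  as-table (inj₂ v) = cong proj₂ (sym (lookup∘tabulate column v))

split-star? : ∀ {m k} {A : Fin m → Fin m → Set} → (∀ u v → Dec (A u v)) →
  (col : Fin m ⊎ Fin m → Fin k) → Dec (StarColouring (SplitAdj A) col)
split-star? A? = star? (search-⊎ search-Fin search-Fin) (SumP.≡-dec Fin._≟_ Fin._≟_) (split? A?)

no-star-table? : ∀ m k {A : Fin m → Fin m → Set} → (∀ u v → Dec (A u v)) →
  Dec (∀ (t : Vec (Column k) m) → ¬ StarColouring (SplitAdj A) (columns (lookup t)))
no-star-table? m k A? = search-Vec (search-× search-Fin search-Fin) λ t → ¬? (split-star? A? (columns (lookup t)))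

SP₄-not-3-star : ∀ (col : Fin 4 ⊎ Fin 4 → Fin 3) → ¬ StarColouring (SplitAdj (PathAdj 4)) col
SP₄-not-3-star = no-star-split (from-yes (no-star-table? 4 3 path?))

SC₃-not-3-star : ∀ (col : Fin 3 ⊎ Fin 3 → Fin 3) → ¬ StarColouring (SplitAdj (CycleAdj 3)) col
SC₃-not-3-star = no-star-split (from-yes (no-star-table? 3 3 cycle?))

path⊆cycle : ∀ {m n} (m≤n : m ≤ suc n) {i j : Fin m} → PathAdj m i j →
  CycleAdj (suc n) (inject≤ i m≤n) (inject≤ j m≤n)
path⊆cycle {n = n} m≤n {i} {j} (inj₁ i+1≡j) rewrite toℕ-inject≤ i m≤n | toℕ-inject≤ j m≤n =
  inj₁ (trans (cong (_% suc n) i+1≡j) (m<n⇒m%n≡m (≤-trans (toℕ<n j) m≤n)))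
path⊆cycle {n = n} m≤n {i} {j} (inj₂ j+1≡i) rewrite toℕ-inject≤ i m≤n | toℕ-inject≤ j m≤n =
  inj₂ (trans (cong (_% suc n) j+1≡i) (m<n⇒m%n≡m (≤-trans (toℕ<n i) m≤n)))

-- Lower bound: S(C_n) has no star colouring with 3 colours, since S(C₃) has none and
-- S(P₄) ⊆ S(C_n) for n ≥ 4; hence none with fewer than 4 colours.
SCₙ-not-3-star : ∀ n → 3 ≤ n → (col : Fin n ⊎ Fin n → Fin 3) → ¬ StarColouring (SplitAdj (CycleAdj n)) col
SCₙ-not-3-star 3 _ = SC₃-not-3-star
SCₙ-not-3-star (suc zero) (s≤s ())
SCₙ-not-3-star (suc (suc zero)) (s≤s (s≤s ()))
SCₙ-not-3-star (suc (suc (suc (suc m)))) _ col star =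
  SP₄-not-3-star _ (star-restrict (splitMap ι) (λ {x} {y} → split-hom (path⊆cycle 4≤n) {x} {y})
                                  (λ {x} {y} → splitMap-injective (inject≤-injective 4≤n 4≤n _ _) {x} {y}) star)
  where
  4≤n : 4 ≤ suc (suc (suc (suc m)))
  4≤n = s≤s (s≤s (s≤s (s≤s z≤n)))
  ι : Fin 4 → Fin (suc (suc (suc (suc m))))
  ι o = inject≤ o 4≤n

SCₙ-needs-4 : ∀ n → 3 ≤ n → ∀ j → j < 4 → ¬ StarColourable (SplitAdj (CycleAdj n)) j
SCₙ-needs-4 n 3≤n j (s≤s j≤3) colourable with star-colourable-mono j≤3 colourable
... | col , star = SCₙ-not-3-star n 3≤n col star

Good : ∀ {k} → Column k → Column k → Column k → Column k → Set
Good a b c d = StarColouring (SplitAdj (PathAdj 4)) (columns (lookup (a ∷ b ∷ c ∷ d ∷ [])))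

Windows : ∀ {k} → List (Column k) → Set
Windows (a ∷ b ∷ c ∷ d ∷ w) = Good a b c d × Windows (b ∷ c ∷ d ∷ w)
Windows _ = ⊤

CyclicallyGood : ∀ {k} → List (Column k) → Set
CyclicallyGood w = Windows (w ++ take 3 w)

good-cong : ∀ {k} {a b c d a′ b′ c′ d′ : Column k} → a ≡ a′ → b ≡ b′ → c ≡ c′ → d ≡ d′ →
  Good a b c d → Good a′ b′ c′ d′
good-cong refl refl refl refl good = good

-- The q-th letter of a list (a default value beyond its end).
nth : ∀ {A : Set} → A → List A → ℕ → A
nth d [] q = d
nth d (a ∷ w) zero = a
nth d (a ∷ w) (suc q) = nth d w q

module _ {A : Set} (d : A) where

  nth-++ˡ : ∀ (w v : List A) {q} → q < length w → nth d (w ++ v) q ≡ nth d w q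
  nth-++ˡ (a ∷ w) v {zero} _ = refl
  nth-++ˡ (a ∷ w) v {suc q} (s≤s q<w) = nth-++ˡ w v q<w

  nth-++ʳ : ∀ (w v : List A) {q} → length w ≤ q → nth d (w ++ v) q ≡ nth d v (q ∸ length w)
  nth-++ʳ [] v _ = refl
  nth-++ʳ (a ∷ w) v {suc q} (s≤s w≤q) = nth-++ʳ w v w≤q

  nth-take : ∀ k (w : List A) {q} → q < k → nth d (take k w) q ≡ nth d w q
  nth-take (suc k) [] _ = refl
  nth-take (suc k) (a ∷ w) {zero} _ = refl
  nth-take (suc k) (a ∷ w) {suc q} (s≤s q<k) = nth-take k w q<k

window-at : ∀ {k} (d : Column k) (L : List (Column k)) p → Windows L → 3 + p < length L →
  Good (nth d L p) (nth d L (1 + p)) (nth d L (2 + p)) (nth d L (3 + p))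
window-at d (a ∷ b ∷ c ∷ e ∷ L) zero (good , _) _ = good
window-at d (a ∷ b ∷ c ∷ e ∷ L) (suc p) (_ , rest) (s≤s bound) = window-at d (b ∷ c ∷ e ∷ L) p rest bound
window-at d [] p _ ()
window-at d (a ∷ []) p _ (s≤s ())
window-at d (a ∷ b ∷ []) p _ (s≤s (s≤s ()))
window-at d (a ∷ b ∷ c ∷ []) p _ (s≤s (s≤s (s≤s ())))

cyclic-nth : ∀ {A : Set} (d : A) (w : List A) .{{_ : NonZero (length w)}} → 3 ≤ length w →
  ∀ q → q < length w + 3 → nth d (w ++ take 3 w) q ≡ nth d w (q % length w)
cyclic-nth d w 3≤n q q<n+3 with q <? length w
... | yes q<n = trans (nth-++ˡ d w _ q<n) (cong (nth d w) (sym (m<n⇒m%n≡m q<n)))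
... | no q≮n = begin
  nth d (w ++ take 3 w) q    ≡⟨ nth-++ʳ d w _ n≤q ⟩
  nth d (take 3 w) (q ∸ n)   ≡⟨ nth-take d 3 w r<3 ⟩
  nth d w (q ∸ n)            ≡⟨ cong (nth d w) r≡q%n ⟩
  nth d w (q % n)            ∎
  where
  open ≡-Reasoning
  n = length w
  n≤q : n ≤ q
  n≤q = ≮⇒≥ q≮n
  r<3 : q ∸ n < 3
  r<3 = subst (q ∸ n <_) (m+n∸m≡n n 3) (∸-monoˡ-< q<n+3 n≤q)
  r≡q%n : q ∸ n ≡ q % n
  r≡q%n = trans (sym (m<n⇒m%n≡m (≤-trans r<3 3≤n))) (m≤n⇒[n∸m]%m≡n%m n≤q)

-- Each window of C_n carries the colouring of S(P₄) by four
-- cyclically consecutive letters, which is good; conclude by the local-to-global principle.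
module WordColouring {k} (a b c : Column k) (w : List (Column k)) where

  word : List (Column k)
  word = a ∷ b ∷ c ∷ w

  n : ℕ
  n = length word

  3≤n : 3 ≤ n
  3≤n = s≤s (s≤s (s≤s z≤n))

  colouring : Fin n ⊎ Fin n → Fin k
  colouring = columns (λ i → nth a word (toℕ i))

  letter : ℕ → Column k
  letter q = nth a word (q % n)

  -- The cyclic window at any s ∈ ℕ is the window at position s mod n of word ++ take 3 word.
  window-good : CyclicallyGood word → ∀ s → Good (letter s) (letter (1 + s)) (letter (2 + s)) (letter (3 + s))
  window-good good s =
    good-cong (shifted 0 z≤n) (shifted 1 1≤3) (shifted 2 2≤3) (shifted 3 3≤3)
      (window-at a (word ++ take 3 word) p good (subst (3 + p <_) (sym (length-++ word)) (in-range 3 3≤3)))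
    where
    1≤3 : 1 ≤ 3
    1≤3 = s≤s z≤n
    2≤3 : 2 ≤ 3
    2≤3 = s≤s (s≤s z≤n)
    3≤3 : 3 ≤ 3
    3≤3 = s≤s (s≤s (s≤s z≤n))
    p = s % n
    in-range : ∀ t → t ≤ 3 → t + p < n + 3
    in-range t t≤3 = subst (t + p <_) (+-comm 3 n) (+-mono-≤-< t≤3 (m%n<n s n))
    shifted : ∀ t → t ≤ 3 → nth a (word ++ take 3 word) (t + p) ≡ letter (t + s)
    shifted t t≤3 = trans (cyclic-nth a word 3≤n (t + p) (in-range t t≤3))
                          (cong (nth a word) (%-absorbʳ t s n))

  window-column : ∀ s o → lookup (tabulate (λ o → letter (toℕ o + s))) o ≡ nth a word (toℕ (window n s o))
  window-column s o = trans (lookup∘tabulate (λ o → letter (toℕ o + s)) o)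
                            (cong (nth a word) (sym (toℕ-fromℕ< (m%n<n (toℕ o + s) n))))

  window-colouring : ∀ s → columns (lookup (tabulate (λ o → letter (toℕ o + s)))) ≗ colouring ∘ splitMap (window n s)
  window-colouring s (inj₁ o) = cong proj₁ (window-column s o)
  window-colouring s (inj₂ o) = cong proj₂ (window-column s o)

  word-star : CyclicallyGood word → StarColouring (SplitAdj (CycleAdj n)) colouring
  word-star good =
    star-local (λ {x} {y} → split-sym Sum.swap {x} {y}) (split-cover (cycle-cover (length (b ∷ c ∷ w))))
               (λ s → star-cong (window-colouring s) (window-good good s))

-- Goodness is decidable, so that concrete words are checked by evaluation.
windows? : ∀ {k} (L : List (Column k)) → Dec (Windows L)
windows? (a ∷ b ∷ c ∷ d ∷ L) = split-star? path? _ ×-dec windows? (b ∷ c ∷ d ∷ L)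
windows? [] = yes tt
windows? (a ∷ []) = yes tt
windows? (a ∷ b ∷ []) = yes tt
windows? (a ∷ b ∷ c ∷ []) = yes tt

good? : ∀ {k} (a b c d : Column k) → Dec (Good a b c d)
good? a b c d = split-star? path? _

-- Repeating a period abc whose three cyclic windows are good preserves cyclic goodness:
-- the windows of (abc)^(j+2) T are those of (abc)^(j+1) T plus the three periodic ones.
periodic : ∀ {k} {a b c : Column k} (T : List (Column k)) → Good a b c a → Good b c a b → Good c a b c →
  CyclicallyGood (a ∷ b ∷ c ∷ T) → ∀ j → CyclicallyGood (a ∷ b ∷ c ∷ concat (replicate j (a ∷ b ∷ c ∷ [])) ++ T)
periodic T g₁ g₂ g₃ seed zero = seed
periodic T g₁ g₂ g₃ seed (suc j) = g₁ , g₂ , g₃ , periodic T g₁ g₂ g₃ seed j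

length-periodic : ∀ {A : Set} (a b c : A) (T : List A) j →
  length (a ∷ b ∷ c ∷ concat (replicate j (a ∷ b ∷ c ∷ [])) ++ T) ≡ suc j * 3 + length T
length-periodic a b c T zero = refl
length-periodic a b c T (suc j) = cong (3 +_) (length-periodic a b c T j)

periodic-colourable : ∀ {k} (a b c : Column k) (T : List (Column k)) →
  Good a b c a → Good b c a b → Good c a b c → CyclicallyGood (a ∷ b ∷ c ∷ T) →
  ∀ j → StarColourable (SplitAdj (CycleAdj (suc j * 3 + length T))) k
periodic-colourable {k} a b c T g₁ g₂ g₃ seed j =
  subst (λ n → StarColourable (SplitAdj (CycleAdj n)) k) (length-periodic a b c T j)
    (colouring , word-star (periodic T g₁ g₂ g₃ seed j))
  where open WordColouring a b c (concat (replicate j (a ∷ b ∷ c ∷ [])) ++ T)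

cyclicallyGood? : ∀ {k} (w : List (Column k)) → Dec (CyclicallyGood w)
cyclicallyGood? w = windows? (w ++ take 3 w)

a₁ a₂ a₃ : ∀ {k} → Column (4 + k)
a₁ = # 0 , # 0
a₂ = # 1 , # 2
a₃ = # 3 , # 2

-- S(C_n) for n = 3(j+1) + |T|, coloured by (a₁a₂a₃)^(j+1) T; the hypotheses are decided
-- by evaluation, so at concrete T and k they are discharged by tt.
periodic-a-colourable : ∀ k (T : List (Column (4 + k))) → True (cyclicallyGood? (a₁ ∷ a₂ ∷ a₃ ∷ T)) →
  True (good? {4 + k} a₁ a₂ a₃ a₁) → True (good? {4 + k} a₂ a₃ a₁ a₂) → True (good? {4 + k} a₃ a₁ a₂ a₃) →
  ∀ j → StarColourable (SplitAdj (CycleAdj (suc j * 3 + length T))) (4 + k)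
periodic-a-colourable k T seed g₁ g₂ g₃ = periodic-colourable a₁ a₂ a₃ T
  (toWitness {a? = good? a₁ a₂ a₃ a₁} g₁) (toWitness {a? = good? a₂ a₃ a₁ a₂} g₂)
  (toWitness {a? = good? a₃ a₁ a₂ a₃} g₃)
  (toWitness {a? = cyclicallyGood? (a₁ ∷ a₂ ∷ a₃ ∷ T)} seed)

B : List (Column 4)
B = (# 1 , # 2) ∷ (# 0 , # 0) ∷ (# 3 , # 2) ∷ (# 1 , # 2) ∷ (# 3 , # 2) ∷ []

SC-multiple-of-3 : ∀ j → StarColourable (SplitAdj (CycleAdj (suc j * 3 + 0))) 4
SC-multiple-of-3 = periodic-a-colourable 0 [] _ _ _ _

SC-2-mod-3 : ∀ j → StarColourable (SplitAdj (CycleAdj (suc j * 3 + 5))) 4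
SC-2-mod-3 = periodic-a-colourable 0 B _ _ _ _

SC-1-mod-3 : ∀ j → StarColourable (SplitAdj (CycleAdj (suc j * 3 + 1))) 5
SC-1-mod-3 = periodic-a-colourable 1 ((# 4 , # 2) ∷ []) _ _ _ _

SC₅-colourable : StarColourable (SplitAdj (CycleAdj 5)) 5
SC₅-colourable = colouring , word-star (toWitness {a? = cyclicallyGood? word} _)
  where open WordColouring (# 0 , # 1) (# 2 , # 3) (# 1 , # 4) ((# 3 , # 0) ∷ (# 4 , # 2) ∷ [])

data Shape : ℕ → Set where
  0-mod-3 : ∀ j → Shape (suc j * 3 + 0)
  1-mod-3 : ∀ j → Shape (suc j * 3 + 1)
  five    : Shape 5
  2-mod-3 : ∀ j → Shape (suc j * 3 + 5)

shape : ∀ n → 3 ≤ n → Shape n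
shape 1 (s≤s ())
shape 2 (s≤s (s≤s ()))
shape 3 _ = 0-mod-3 0
shape 4 _ = 1-mod-3 0
shape 5 _ = five
shape (suc (suc (suc n@(suc (suc (suc _)))))) _ with shape n (s≤s (s≤s (s≤s z≤n)))
... | 0-mod-3 j = 0-mod-3 (suc j)
... | 1-mod-3 j = 1-mod-3 (suc j)
... | five      = 2-mod-3 0
... | 2-mod-3 j = 2-mod-3 (suc j)

1-mod-3-residue : ∀ j → (suc j * 3 + 1) % 3 ≡ 1
1-mod-3-residue j = trans (cong (_% 3) (+-comm (suc j * 3) 1)) ([m+kn]%n≡m%n 1 (suc j) 3)

SCₙ-4-colourable : ∀ n → 3 ≤ n → n % 3 ≢ 1 → n ≢ 5 → StarColourable (SplitAdj (CycleAdj n)) 4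
SCₙ-4-colourable n 3≤n ≢1 ≢5 with shape n 3≤n
... | 0-mod-3 j = SC-multiple-of-3 j
... | 1-mod-3 j = ⊥-elim (≢1 (1-mod-3-residue j))
... | five      = ⊥-elim (≢5 refl)
... | 2-mod-3 j = SC-2-mod-3 j

SCₙ-5-colourable : ∀ n → 3 ≤ n → StarColourable (SplitAdj (CycleAdj n)) 5
SCₙ-5-colourable n 3≤n with shape n 3≤n
... | 0-mod-3 j = star-colourable-mono (s≤s (s≤s (s≤s (s≤s z≤n)))) (SC-multiple-of-3 j)
... | 1-mod-3 j = SC-1-mod-3 j
... | five      = SC₅-colourable
... | 2-mod-3 j = star-colourable-mono (s≤s (s≤s (s≤s (s≤s z≤n)))) (SC-2-mod-3 j)

theorem5 : (n : ℕ) → 3 ≤ n →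
    ((n % 3 ≢ 1) × (n ≢ 5) → StarChromaticNumberIs (SplitAdj (CycleAdj n)) 4) ×
    ((n % 3 ≡ 1) ⊎ (n ≡ 5) → StarChromaticAtMost (SplitAdj (CycleAdj n)) 5)
theorem5 n 3≤n =
  (λ (≢1 , ≢5) → SCₙ-4-colourable n 3≤n ≢1 ≢5 , SCₙ-needs-4 n 3≤n) ,
  (λ _ → SCₙ-5-colourable n 3≤n)
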